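{- For every integer $n \geq 0$, $$C_n = (-1)^{n+1}\frac{4^n(2n-1)}{(n+1)!}\sum_{m=0}^n \left(\frac12\right)^m S_1(n,m).$$
   Context: $C_n = \frac{1}{n+1}\binom{2n}{n}$ is the $n$-th Catalan number. The Stirling numbers of the first kind $S_1(n,l)$ are defined by $x(x-1)\cdots(x-n+1) = \sum_{l=0}^n S_1(n,l)x^l$. -}

module Defs where

open import Data.Nat as ℕ using (ℕ; zero; suc)
open import Data.Nat.Combinatorics using (_C_)
open import Data.Nat.Properties using (_!≢0)
open import Data.Integer as ℤ using (ℤ; +_)
open import Data.List using (List; []; _∷_)
open import Data.Rational as ℚ using (ℚ; _/_)

-- Polynomials over ℤ as coefficient lists, lowest degree first.
Poly : Set
Poly = List ℤ

_⊕_ : Poly → Poly → Poly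
[] ⊕ q = q
(a ∷ p) ⊕ [] = a ∷ p
(a ∷ p) ⊕ (b ∷ q) = (a ℤ.+ b) ∷ (p ⊕ q)

_⊛_ : ℤ → Poly → Poly
c ⊛ [] = []
c ⊛ (a ∷ p) = (c ℤ.* a) ∷ (c ⊛ p)

mulXminus : ℤ → Poly → Poly
mulXminus c p = (+ 0 ∷ p) ⊕ ((ℤ.- c) ⊛ p)

fallingPoly : ℕ → Poly
fallingPoly zero = + 1 ∷ []
fallingPoly (suc n) = mulXminus (+ n) (fallingPoly n)

coeff : Poly → ℕ → ℤ
coeff [] l = + 0
coeff (a ∷ p) zero = a
coeff (a ∷ p) (suc l) = coeff p l

S₁ : ℕ → ℕ → ℤ
S₁ n l = coeff (fallingPoly n) l

catalan : ℕ → ℚ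
catalan n = (+ ((2 ℕ.* n) C n)) / suc n

_^ℚ_ : ℚ → ℕ → ℚ
q ^ℚ zero = ℚ.1ℚ
q ^ℚ suc n = q ℚ.* (q ^ℚ n)

sumTo : ℕ → (ℕ → ℚ) → ℚ
sumTo zero f = f 0
sumTo (suc n) f = sumTo n f ℚ.+ f (suc n)

_/fact_ : ℤ → ℕ → ℚ
z /fact k = (z / (k ℕ.!)) {{k !≢0}}

-- By definition of S₁, the sum Σ_{m≤n} xᵐ S₁(n,m) is the falling factorial
-- x(x-1)⋯(x-n+1).  At x = ½ the falling factorial equals Pₙ/2ⁿ with
-- Pₙ = ∏_{k<n}(1-2k), and (-1)ⁿ⁺¹(2n-1)Pₙ = (-1)ⁿPₙ₊₁ is the odd double factorial
-- (2n-1)!! = 1·3⋯(2n-1).  Finally 2ⁿ·n!·(2n-1)!! = (2n)! = C(2n,n)·n!², so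
-- 4ⁿ(2n-1)!!/(2ⁿ(n+1)!) = C(2n,n)/(n+1).
module Submission where

open import Defs
open import Data.Nat as ℕ using (ℕ; zero; suc; _!; s≤s; NonZero)
import Data.Nat.Properties as ℕP
open import Algebra.Properties.CommutativeSemigroup ℕP.*-commutativeSemigroup using (xy∙z≈xz∙y)
open import Data.Nat.Combinatorics using (_C_; nCk≡n!/k![n-k]!; k![n∸k]!∣n!)
open import Data.Nat.DivMod using (m/n*n≡m)
open import Data.Integer as ℤ using (ℤ; +_)
import Data.Integer.Properties as ℤP
open import Data.List using ([]; _∷_; length)
open import Data.Rational as ℚ using (ℚ; _/_; _+_; _*_; _-_; 0ℚ; 1ℚ; ½)
import Data.Rational.Properties as ℚP
open import Data.Rational.Unnormalised as ℚᵘ using (mkℚᵘ; _≃_; *≡*)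
import Data.Rational.Unnormalised.Properties as ℚᵘP
open import Data.Rational.Solver using (module +-*-Solver)
import Data.Nat.Tactic.RingSolver as ℕ-Ring
import Data.Integer.Tactic.RingSolver as ℤ-Ring
open import Relation.Binary.PropositionalEquality

open +-*-Solver using (solve; _:+_; _:*_; _:-_; :-_; con; _:=_)

-- Fractions.  `a / d` normalises, so we compute with arbitrary numerators and
-- denominators by passing to unnormalised rationals, where these rules hold
-- on the nose.

ι : ℤ → ℚ
ι z = z / 1

toℚᵘ-/ : ∀ a d .{{_ : NonZero d}} → ℚ.toℚᵘ (a / d) ≃ (a ℚᵘ./ d)
toℚᵘ-/ a (suc k) = ℚP.toℚᵘ-fromℚᵘ (mkℚᵘ a k)

/-* : ∀ a b d e .{{_ : NonZero d}} .{{_ : NonZero e}} →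
      (a / d) * (b / e) ≡ ((a ℤ.* b) / (d ℕ.* e)) {{ℕP.m*n≢0 d e}}
/-* a b d@(suc _) e@(suc _) = ℚP.toℚᵘ-injective (ℚᵘP.≃-trans
  (ℚP.toℚᵘ-homo-* (a / d) (b / e))
  (ℚᵘP.≃-trans (ℚᵘP.*-cong (toℚᵘ-/ a d) (toℚᵘ-/ b e)) (ℚᵘP.≃-sym (toℚᵘ-/ (a ℤ.* b) (d ℕ.* e)))))

/-+ : ∀ a b d e .{{_ : NonZero d}} .{{_ : NonZero e}} →
      (a / d) + (b / e) ≡ ((a ℤ.* + e ℤ.+ b ℤ.* + d) / (d ℕ.* e)) {{ℕP.m*n≢0 d e}}
/-+ a b d@(suc _) e@(suc _) = ℚP.toℚᵘ-injective (ℚᵘP.≃-trans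
  (ℚP.toℚᵘ-homo-+ (a / d) (b / e))
  (ℚᵘP.≃-trans (ℚᵘP.+-cong (toℚᵘ-/ a d) (toℚᵘ-/ b e)) (ℚᵘP.≃-sym (toℚᵘ-/ _ (d ℕ.* e)))))

-‿/ : ∀ a d .{{_ : NonZero d}} → ℚ.- (a / d) ≡ (ℤ.- a) / d
-‿/ a d@(suc _) = ℚP.toℚᵘ-injective (ℚᵘP.≃-trans
  (ℚP.toℚᵘ-homo‿- (a / d))
  (ℚᵘP.≃-trans (ℚᵘP.-‿cong (toℚᵘ-/ a d)) (ℚᵘP.≃-sym (toℚᵘ-/ (ℤ.- a) d))))

/-cross : ∀ a b d e .{{_ : NonZero d}} .{{_ : NonZero e}} →
          a ℤ.* + e ≡ b ℤ.* + d → a / d ≡ b / e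
/-cross a b d@(suc _) e@(suc _) eq = ℚP.toℚᵘ-injective
  (ℚᵘP.≃-trans (toℚᵘ-/ a d) (ℚᵘP.≃-trans (*≡* eq) (ℚᵘP.≃-sym (toℚᵘ-/ b e))))

ι-+ : ∀ a b → ι (a ℤ.+ b) ≡ ι a + ι b
ι-+ a b = sym (trans (/-+ a b 1 1)
  (ℚP./-cong (cong₂ ℤ._+_ (ℤP.*-identityʳ a) (ℤP.*-identityʳ b)) refl))

ι-* : ∀ a b → ι (a ℤ.* b) ≡ ι a * ι b
ι-* a b = sym (/-* a b 1 1)

ι-neg : ∀ a → ι (ℤ.- a) ≡ ℚ.- ι a
ι-neg a = sym (-‿/ a 1)

ι-*-/ : ∀ s a d .{{_ : NonZero d}} → ι s * (a / d) ≡ (s ℤ.* a) / d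
ι-*-/ s a d = trans (/-* s a 1 d) (ℚP./-cong {p₁ = s ℤ.* a} {{ℕP.m*n≢0 1 d}} refl (ℕP.*-identityˡ d))

sumTo-cong : ∀ n {f g : ℕ → ℚ} → (∀ m → f m ≡ g m) → sumTo n f ≡ sumTo n g
sumTo-cong zero    f≡g = f≡g 0
sumTo-cong (suc n) f≡g = cong₂ _+_ (sumTo-cong n f≡g) (f≡g (suc n))

sumTo-zero : ∀ n → sumTo n (λ _ → 0ℚ) ≡ 0ℚ
sumTo-zero zero    = refl
sumTo-zero (suc n) = cong (_+ 0ℚ) (sumTo-zero n)

sumTo-suc : ∀ n f → sumTo (suc n) f ≡ f 0 + sumTo n (λ m → f (suc m))
sumTo-suc zero    f = refl
sumTo-suc (suc n) f = trans (cong (_+ f (suc (suc n))) (sumTo-suc n f)) (ℚP.+-assoc (f 0) _ _)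

sumTo-*ˡ : ∀ n c f → sumTo n (λ m → c * f m) ≡ c * sumTo n f
sumTo-*ˡ zero    c f = refl
sumTo-*ˡ (suc n) c f = trans (cong (_+ c * f (suc n)) (sumTo-*ˡ n c f)) (sym (ℚP.*-distribˡ-+ c _ _))

eval : Poly → ℚ → ℚ
eval []      x = 0ℚ
eval (a ∷ p) x = ι a + x * eval p x

eval-⊕ : ∀ p q x → eval (p ⊕ q) x ≡ eval p x + eval q x
eval-⊕ []      q       x = sym (ℚP.+-identityˡ _)
eval-⊕ (a ∷ p) []      x = sym (ℚP.+-identityʳ _)
eval-⊕ (a ∷ p) (b ∷ q) x rewrite ι-+ a b | eval-⊕ p q x =
  solve 5 (λ A B X P Q → A :+ B :+ X :* (P :+ Q) := A :+ X :* P :+ (B :+ X :* Q))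
    refl (ι a) (ι b) x (eval p x) (eval q x)

eval-⊛ : ∀ c p x → eval (c ⊛ p) x ≡ ι c * eval p x
eval-⊛ c []      x = sym (ℚP.*-zeroʳ (ι c))
eval-⊛ c (a ∷ p) x rewrite ι-* c a | eval-⊛ c p x =
  solve 4 (λ C A X P → C :* A :+ X :* (C :* P) := C :* (A :+ X :* P))
    refl (ι c) (ι a) x (eval p x)

eval-mulXminus : ∀ c p x → eval (mulXminus c p) x ≡ (x - ι c) * eval p x
eval-mulXminus c p x rewrite eval-⊕ (+ 0 ∷ p) ((ℤ.- c) ⊛ p) x | eval-⊛ (ℤ.- c) p x | ι-neg c =
  solve 3 (λ X C P → con 0ℚ :+ X :* P :+ (:- C) :* P := (X :- C) :* P) refl x (ι c) (eval p x)

coefficientSum : ∀ x n p → length p ℕ.≤ suc n →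
  sumTo n (λ m → (x ^ℚ m) * ι (coeff p m)) ≡ eval p x
coefficientSum x n [] _ = trans (sumTo-cong n (λ m → ℚP.*-zeroʳ (x ^ℚ m))) (sumTo-zero n)
coefficientSum x zero (a ∷ []) _ =
  trans (ℚP.*-identityˡ (ι a)) (solve 2 (λ A X → A := A :+ X :* con 0ℚ) refl (ι a) x)
coefficientSum x zero (a ∷ _ ∷ _) (s≤s ())
coefficientSum x (suc n) (a ∷ p) (s≤s len≤) = begin
  sumTo (suc n) (λ m → (x ^ℚ m) * ι (coeff (a ∷ p) m))
    ≡⟨ sumTo-suc n _ ⟩
  1ℚ * ι a + sumTo n (λ m → x * (x ^ℚ m) * ι (coeff p m))
    ≡⟨ cong₂ _+_ (ℚP.*-identityˡ (ι a)) (sumTo-cong n (λ m → ℚP.*-assoc x (x ^ℚ m) _)) ⟩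
  ι a + sumTo n (λ m → x * ((x ^ℚ m) * ι (coeff p m)))
    ≡⟨ cong (_+_ (ι a)) (trans (sumTo-*ˡ n x _) (cong (x *_) (coefficientSum x n p len≤))) ⟩
  ι a + x * eval p x ∎
  where open ≡-Reasoning

length-⊕ : ∀ p q → length (p ⊕ q) ≡ length p ℕ.⊔ length q
length-⊕ []      q       = refl
length-⊕ (a ∷ p) []      = refl
length-⊕ (a ∷ p) (b ∷ q) = cong suc (length-⊕ p q)

length-⊛ : ∀ c p → length (c ⊛ p) ≡ length p
length-⊛ c []      = refl
length-⊛ c (a ∷ p) = cong suc (length-⊛ c p)

length-fallingPoly : ∀ n → length (fallingPoly n) ≡ suc n
length-fallingPoly zero    = refl
length-fallingPoly (suc n) = begin
  length (fallingPoly (suc n))                  ≡⟨ length-⊕ (+ 0 ∷ f) ((ℤ.- + n) ⊛ f) ⟩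
  suc (length f) ℕ.⊔ length ((ℤ.- + n) ⊛ f)     ≡⟨ cong (suc (length f) ℕ.⊔_) (length-⊛ _ f) ⟩
  suc (length f) ℕ.⊔ length f                   ≡⟨ ℕP.m≥n⇒m⊔n≡m (ℕP.n≤1+n (length f)) ⟩
  suc (length f)                                ≡⟨ cong suc (length-fallingPoly n) ⟩
  suc (suc n) ∎
  where
  open ≡-Reasoning
  f : Poly
  f = fallingPoly n

falling : ℚ → ℕ → ℚ
falling x zero    = 1ℚ
falling x (suc n) = (x - ι (+ n)) * falling x n

eval-fallingPoly : ∀ n x → eval (fallingPoly n) x ≡ falling x n
eval-fallingPoly zero    x = solve 1 (λ X → con 1ℚ :+ X :* con 0ℚ := con 1ℚ) refl x
eval-fallingPoly (suc n) x =
  trans (eval-mulXminus (+ n) (fallingPoly n) x) (cong ((x - ι (+ n)) *_) (eval-fallingPoly n x))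

stirling-falling : ∀ x n → sumTo n (λ m → (x ^ℚ m) * ι (S₁ n m)) ≡ falling x n
stirling-falling x n = trans
  (coefficientSum x n (fallingPoly n) (ℕP.≤-reflexive (length-fallingPoly n)))
  (eval-fallingPoly n x)

2^n≢0 : ∀ n → NonZero (2 ℕ.^ n)
2^n≢0 n = ℕP.m^n≢0 2 n

-- Pₙ = ∏_{k<n} (1-2k), so that ½(½-1)⋯(½-n+1) = Pₙ/2ⁿ.
halfNumerator : ℕ → ℤ
halfNumerator zero    = + 1
halfNumerator (suc n) = (+ 1 ℤ.- + (2 ℕ.* n)) ℤ.* halfNumerator n

½-minus : ∀ n → ½ - ι (+ n) ≡ (+ 1 ℤ.- + (2 ℕ.* n)) / 2
½-minus n = begin
  ½ - ι (+ n)                                     ≡⟨ cong (_+_ ½) (-‿/ (+ n) 1) ⟩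
  ½ + (ℤ.- + n) / 1                               ≡⟨ /-+ (+ 1) (ℤ.- + n) 2 1 ⟩
  (+ 1 ℤ.* + 1 ℤ.+ (ℤ.- + n) ℤ.* + 2) / 2         ≡⟨ ℚP./-cong numerator refl ⟩
  (+ 1 ℤ.- + (2 ℕ.* n)) / 2 ∎
  where
  open ≡-Reasoning
  identity : ∀ m → + 1 ℤ.* + 1 ℤ.+ (ℤ.- m) ℤ.* + 2 ≡ + 1 ℤ.- + 2 ℤ.* m
  identity = ℤ-Ring.solve-∀
  numerator : + 1 ℤ.* + 1 ℤ.+ (ℤ.- + n) ℤ.* + 2 ≡ + 1 ℤ.- + (2 ℕ.* n)
  numerator = trans (identity (+ n)) (cong (ℤ._-_ (+ 1)) (sym (ℤP.pos-* 2 n)))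

falling-½ : ∀ n → falling ½ n ≡ (halfNumerator n / 2 ℕ.^ n) {{2^n≢0 n}}
falling-½ zero    = refl
falling-½ (suc n) =
  trans (cong₂ _*_ (½-minus n) (falling-½ n))
        (/-* (+ 1 ℤ.- + (2 ℕ.* n)) (halfNumerator n) 2 (2 ℕ.^ n) {{_}} {{2^n≢0 n}})

sign : ℕ → ℤ
sign zero    = + 1
sign (suc k) = ℤ.- + 1 ℤ.* sign k

sign-ι : ∀ k → (ℚ.- 1ℚ) ^ℚ k ≡ ι (sign k)
sign-ι zero    = refl
sign-ι (suc k) = trans (cong₂ _*_ (-‿/ (+ 1) 1) (sign-ι k)) (sym (ι-* (ℤ.- + 1) (sign k)))

oddFactorial : ℕ → ℕ
oddFactorial zero    = 1
oddFactorial (suc n) = suc (2 ℕ.* n) ℕ.* oddFactorial n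

sign-halfNumerator : ∀ n → sign n ℤ.* halfNumerator (suc n) ≡ + oddFactorial n
sign-halfNumerator zero    = refl
sign-halfNumerator (suc n) = begin
  sign (suc n) ℤ.* ((+ 1 ℤ.- + (2 ℕ.* suc n)) ℤ.* P)
    ≡⟨ cong (λ t → sign (suc n) ℤ.* ((+ 1 ℤ.- + t) ℤ.* P)) (ℕP.*-suc 2 n) ⟩
  sign (suc n) ℤ.* ((+ 1 ℤ.- (+ 2 ℤ.+ + (2 ℕ.* n))) ℤ.* P)
    ≡⟨ identity (sign n) (+ (2 ℕ.* n)) P ⟩
  + suc (2 ℕ.* n) ℤ.* (sign n ℤ.* P)
    ≡⟨ cong (+ suc (2 ℕ.* n) ℤ.*_) (sign-halfNumerator n) ⟩
  + suc (2 ℕ.* n) ℤ.* + oddFactorial n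
    ≡⟨ sym (ℤP.pos-* (suc (2 ℕ.* n)) (oddFactorial n)) ⟩
  + oddFactorial (suc n) ∎
  where
  open ≡-Reasoning
  P : ℤ
  P = halfNumerator (suc n)
  identity : ∀ s t q → ℤ.- + 1 ℤ.* s ℤ.* ((+ 1 ℤ.- (+ 2 ℤ.+ t)) ℤ.* q) ≡ (+ 1 ℤ.+ t) ℤ.* (s ℤ.* q)
  identity = ℤ-Ring.solve-∀

-- 2ⁿ·n!·(2n-1)!! = (2n)!: the even factors 2·4⋯2n of (2n)! contribute 2ⁿ·n!.
oddFactorial-factorial : ∀ n → 2 ℕ.^ n ℕ.* n ! ℕ.* oddFactorial n ≡ (2 ℕ.* n) !
oddFactorial-factorial zero    = refl
oddFactorial-factorial (suc n) = begin
  2 ℕ.^ suc n ℕ.* suc n ! ℕ.* oddFactorial (suc n)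
    ≡⟨ identity n (2 ℕ.^ n) (n !) (oddFactorial n) ⟩
  suc (suc (2 ℕ.* n)) ℕ.* (suc (2 ℕ.* n) ℕ.* (2 ℕ.^ n ℕ.* n ! ℕ.* oddFactorial n))
    ≡⟨ cong (λ z → suc (suc (2 ℕ.* n)) ℕ.* (suc (2 ℕ.* n) ℕ.* z)) (oddFactorial-factorial n) ⟩
  (2 ℕ.+ 2 ℕ.* n) !
    ≡⟨ cong _! (sym (ℕP.*-suc 2 n)) ⟩
  (2 ℕ.* suc n) ! ∎
  where
  open ≡-Reasoning
  identity : ∀ m t f o → (2 ℕ.* t) ℕ.* ((1 ℕ.+ m) ℕ.* f) ℕ.* ((1 ℕ.+ 2 ℕ.* m) ℕ.* o)
                         ≡ (2 ℕ.+ 2 ℕ.* m) ℕ.* ((1 ℕ.+ 2 ℕ.* m) ℕ.* (t ℕ.* f ℕ.* o))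
  identity = ℕ-Ring.solve-∀

centralBinomial-factorial : ∀ n → ((2 ℕ.* n) C n) ℕ.* (n ! ℕ.* n !) ≡ (2 ℕ.* n) !
centralBinomial-factorial n =
  subst (λ k → ((2 ℕ.* n) C n) ℕ.* (n ! ℕ.* k !) ≡ (2 ℕ.* n) !) 2n∸n≡n
    (trans (cong (ℕ._* (n ! ℕ.* (2 ℕ.* n ℕ.∸ n) !)) (nCk≡n!/k![n-k]! n≤2n))
           (m/n*n≡m {{n ℕP.!* (2 ℕ.* n ℕ.∸ n) !≢0}} (k![n∸k]!∣n! n≤2n)))
  where
  n≤2n : n ℕ.≤ 2 ℕ.* n
  n≤2n = ℕP.m≤m+n n (n ℕ.+ 0)
  2n∸n≡n : 2 ℕ.* n ℕ.∸ n ≡ n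
  2n∸n≡n = trans (ℕP.m+n∸m≡n n (n ℕ.+ 0)) (ℕP.+-identityʳ n)

-- Comparing the two factorisations of (2n)!: C(2n,n)·n! = 2ⁿ·(2n-1)!!.
centralBinomial-oddFactorial : ∀ n → ((2 ℕ.* n) C n) ℕ.* n ! ≡ 2 ℕ.^ n ℕ.* oddFactorial n
centralBinomial-oddFactorial n = ℕP.*-cancelʳ-≡ _ _ (n !) {{n ℕP.!≢0}} (begin
  ((2 ℕ.* n) C n) ℕ.* n ! ℕ.* n !          ≡⟨ ℕP.*-assoc ((2 ℕ.* n) C n) (n !) (n !) ⟩
  ((2 ℕ.* n) C n) ℕ.* (n ! ℕ.* n !)        ≡⟨ centralBinomial-factorial n ⟩
  (2 ℕ.* n) !                            ≡⟨ sym (oddFactorial-factorial n) ⟩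
  2 ℕ.^ n ℕ.* n ! ℕ.* oddFactorial n     ≡⟨ xy∙z≈xz∙y (2 ℕ.^ n) (n !) (oddFactorial n) ⟩
  2 ℕ.^ n ℕ.* oddFactorial n ℕ.* n ! ∎)
  where open ≡-Reasoning

catalan-cleared : ∀ n →
  ((2 ℕ.* n) C n) ℕ.* (suc n ! ℕ.* 2 ℕ.^ n) ≡ 4 ℕ.^ n ℕ.* oddFactorial n ℕ.* suc n
catalan-cleared n = begin
  B ℕ.* (suc n ℕ.* n ! ℕ.* 2 ℕ.^ n)               ≡⟨ regroup B (suc n) (n !) (2 ℕ.^ n) ⟩
  suc n ℕ.* 2 ℕ.^ n ℕ.* (B ℕ.* n !)               ≡⟨ cong (suc n ℕ.* 2 ℕ.^ n ℕ.*_) (centralBinomial-oddFactorial n) ⟩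
  suc n ℕ.* 2 ℕ.^ n ℕ.* (2 ℕ.^ n ℕ.* O)           ≡⟨ collect (suc n) (2 ℕ.^ n) O ⟩
  2 ℕ.^ n ℕ.* 2 ℕ.^ n ℕ.* O ℕ.* suc n             ≡⟨ cong (λ z → z ℕ.* O ℕ.* suc n) (sym (4^n≡2^n*2^n n)) ⟩
  4 ℕ.^ n ℕ.* O ℕ.* suc n ∎
  where
  open ≡-Reasoning
  B O : ℕ
  B = (2 ℕ.* n) C n
  O = oddFactorial n
  regroup : ∀ b s f t → b ℕ.* (s ℕ.* f ℕ.* t) ≡ s ℕ.* t ℕ.* (b ℕ.* f)
  regroup = ℕ-Ring.solve-∀
  collect : ∀ s t o → s ℕ.* t ℕ.* (t ℕ.* o) ≡ t ℕ.* t ℕ.* o ℕ.* s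
  collect = ℕ-Ring.solve-∀
  4^n≡2^n*2^n : ∀ k → 4 ℕ.^ k ≡ 2 ℕ.^ k ℕ.* 2 ℕ.^ k
  4^n≡2^n*2^n zero    = refl
  4^n≡2^n*2^n (suc k) = trans (cong (4 ℕ.*_) (4^n≡2^n*2^n k)) (square (2 ℕ.^ k))
    where
    square : ∀ t → 4 ℕ.* (t ℕ.* t) ≡ 2 ℕ.* t ℕ.* (2 ℕ.* t)
    square = ℕ-Ring.solve-∀

-- The integer identity behind the corollary: after clearing denominators both
-- sides equal 4ⁿ·(2n-1)!!·(n+1).
numerators-cleared : ∀ n →
  sign (suc n) ℤ.* (+ (4 ℕ.^ n) ℤ.* (+ (2 ℕ.* n) ℤ.- + 1)) ℤ.* halfNumerator n ℤ.* + suc n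
    ≡ + ((2 ℕ.* n) C n) ℤ.* + (suc n ! ℕ.* 2 ℕ.^ n)
numerators-cleared n = begin
  sign (suc n) ℤ.* (+ (4 ℕ.^ n) ℤ.* (+ (2 ℕ.* n) ℤ.- + 1)) ℤ.* halfNumerator n ℤ.* + suc n
    ≡⟨ identity (sign n) (+ (4 ℕ.^ n)) (+ (2 ℕ.* n)) (halfNumerator n) (+ suc n) ⟩
  + (4 ℕ.^ n) ℤ.* (sign n ℤ.* halfNumerator (suc n)) ℤ.* + suc n
    ≡⟨ cong (λ z → + (4 ℕ.^ n) ℤ.* z ℤ.* + suc n) (sign-halfNumerator n) ⟩
  + (4 ℕ.^ n) ℤ.* + oddFactorial n ℤ.* + suc n
    ≡⟨ trans (cong (ℤ._* + suc n) (sym (ℤP.pos-* (4 ℕ.^ n) (oddFactorial n))))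
             (sym (ℤP.pos-* (4 ℕ.^ n ℕ.* oddFactorial n) (suc n))) ⟩
  + (4 ℕ.^ n ℕ.* oddFactorial n ℕ.* suc n)
    ≡⟨ cong +_ (sym (catalan-cleared n)) ⟩
  + (((2 ℕ.* n) C n) ℕ.* (suc n ! ℕ.* 2 ℕ.^ n))
    ≡⟨ ℤP.pos-* ((2 ℕ.* n) C n) _ ⟩
  + ((2 ℕ.* n) C n) ℤ.* + (suc n ! ℕ.* 2 ℕ.^ n) ∎
  where
  open ≡-Reasoning
  identity : ∀ s f t q r →
    ℤ.- + 1 ℤ.* s ℤ.* (f ℤ.* (t ℤ.- + 1)) ℤ.* q ℤ.* r ≡ f ℤ.* (s ℤ.* ((+ 1 ℤ.- t) ℤ.* q)) ℤ.* r
  identity = ℤ-Ring.solve-∀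

corollary9 : (n : ℕ) →
    catalan n ≡
      ((ℚ.- ℚ.1ℚ) ^ℚ suc n) ℚ.*
        (((+ (4 ℕ.^ n)) ℤ.* ((+ (2 ℕ.* n)) ℤ.- (+ 1))) /fact suc n) ℚ.*
          sumTo n (λ m → ((ℚ.½) ^ℚ m) ℚ.* ((S₁ n m) / 1))
corollary9 n = sym (begin
  (ℚ.- 1ℚ) ^ℚ suc n * (A /fact suc n) * sumTo n (λ m → (½ ^ℚ m) * ι (S₁ n m))
    ≡⟨ cong₂ (λ s t → s * (A /fact suc n) * t) (sign-ι (suc n))
             (trans (stirling-falling ½ n) (falling-½ n)) ⟩
  ι (sign (suc n)) * (A / suc n !) {{suc n ℕP.!≢0}} * H
    ≡⟨ cong (_* H) (ι-*-/ (sign (suc n)) A (suc n !) {{suc n ℕP.!≢0}}) ⟩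
  ((sign (suc n) ℤ.* A) / suc n !) {{suc n ℕP.!≢0}} * H
    ≡⟨ /-* (sign (suc n) ℤ.* A) (halfNumerator n) (suc n !) (2 ℕ.^ n)
           {{suc n ℕP.!≢0}} {{2^n≢0 n}} ⟩
  ((sign (suc n) ℤ.* A ℤ.* halfNumerator n) / (suc n ! ℕ.* 2 ℕ.^ n)) {{denominator≢0}}
    ≡⟨ /-cross (sign (suc n) ℤ.* A ℤ.* halfNumerator n) (+ ((2 ℕ.* n) C n))
               (suc n ! ℕ.* 2 ℕ.^ n) (suc n) {{denominator≢0}} (numerators-cleared n) ⟩
  catalan n ∎)
  where
  open ≡-Reasoning
  A : ℤ
  A = + (4 ℕ.^ n) ℤ.* (+ (2 ℕ.* n) ℤ.- + 1)
  H : ℚ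
  H = (halfNumerator n / 2 ℕ.^ n) {{2^n≢0 n}}
  denominator≢0 : NonZero (suc n ! ℕ.* 2 ℕ.^ n)
  denominator≢0 = ℕP.m*n≢0 (suc n !) (2 ℕ.^ n) {{suc n ℕP.!≢0}} {{2^n≢0 n}}
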